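{- Let $S_1$ and $S_2$ be two disjoint sets of cells of an $n\times n$ array, each forming a Hamilton cycle. Then for any positive integers $t$ and $s$ with $s>t+2n$, the cells of $S_1\cup S_2$ can be filled with integers to make a shiftable array whose support is $\{s+i,\,t+i \mid 1\leq i\leq 2n\}$ and in which the four entries in each row and in each column sum to $0$.
   Context: Identify the cells of an $n\times n$ array with the edges of $K_{n,n}$ (cell $(i,j)$ corresponds to edge $\{a_i,b_j\}$); a set of cells forms a Hamilton cycle if the corresponding edges form a single cycle of length $2n$. The support of a partially filled array is the set of absolute values of its entries. A partially filled array is shiftable if each row and each column contains the same number of positive entries as negative entries. -}

module Defs where

open import Data.Nat as ℕ using (ℕ; zero; suc; _≤_; _<_)
open import Data.Nat.DivMod using (_%_; m%n<n)
open import Data.Fin using (Fin; toℕ; fromℕ<)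
open import Data.Integer as ℤ using (ℤ; +_; ∣_∣)
open import Data.Integer using (0ℤ)
open import Data.List using (List; mapMaybe; allFin; length; filter; foldr)
open import Data.Maybe using (Maybe; just; nothing; Is-just)
open import Data.Product using (_×_; _,_; ∃; ∃-syntax; Σ)
open import Data.Sum using (_⊎_)
open import Data.Empty using (⊥)
open import Function.Bundles using (_⇔_)
open import Function.Definitions using (Bijective)
open import Relation.Binary.PropositionalEquality using (_≡_)

-- A cell of an n × n array: (row , column).  Cell (i , j) ↔ edge {a_i , b_j} of K_{n,n}.
Cell : ℕ → Set
Cell n = Fin n × Fin n

CellSet : ℕ → Set₁
CellSet n = Cell n → Set

csuc : ∀ {n} → Fin n → Fin n
csuc {suc m} k = fromℕ< (m%n<n (suc (toℕ k)) (suc m))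

-- S forms a Hamilton cycle of K_{n,n}: the corresponding edges are exactly the
-- edges of a cycle a_{σ0} b_{τ0} a_{σ1} b_{τ1} … a_{σ(n-1)} b_{τ(n-1)} a_{σ0}
-- through all 2n vertices (σ, τ bijections); a cycle of length 2n in the simple
-- graph K_{n,n} requires 2n ≥ 3, i.e. n ≥ 2.
IsHamiltonCycle : ∀ {n} → CellSet n → Set
IsHamiltonCycle {n} S =
  (2 ≤ n) ×
  ∃[ σ ] ∃[ τ ] (Bijective {A = Fin n} {B = Fin n} _≡_ _≡_ σ × Bijective {A = Fin n} {B = Fin n} _≡_ _≡_ τ ×
    (∀ i j → S (i , j) ⇔ (∃[ k ] ((i ≡ σ k × j ≡ τ k) ⊎ (i ≡ σ (csuc k) × j ≡ τ k)))))

Disjoint : ∀ {n} → CellSet n → CellSet n → Set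
Disjoint {n} S T = ∀ c → S c → T c → ⊥

PArray : ℕ → Set
PArray n = Fin n → Fin n → Maybe ℤ

FilledExactly : ∀ {n} → PArray n → CellSet n → Set
FilledExactly {n} A S = ∀ i j → Is-just (A i j) ⇔ S (i , j)

rowEntries : ∀ {n} → PArray n → Fin n → List ℤ
rowEntries {n} A i = mapMaybe (λ j → A i j) (allFin n)

colEntries : ∀ {n} → PArray n → Fin n → List ℤ
colEntries {n} A j = mapMaybe (λ i → A i j) (allFin n)

#pos : List ℤ → ℕ
#pos xs = length (filter (λ x → 0ℤ ℤ.<? x) xs)

#neg : List ℤ → ℕ
#neg xs = length (filter (λ x → x ℤ.<? 0ℤ) xs)

sumℤ : List ℤ → ℤ
sumℤ = foldr ℤ._+_ 0ℤ

Shiftable : ∀ {n} → PArray n → Set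
Shiftable {n} A = (∀ i → #pos (rowEntries A i) ≡ #neg (rowEntries A i))
                × (∀ j → #pos (colEntries A j) ≡ #neg (colEntries A j))

InSupport : ∀ {n} → PArray n → ℕ → Set
InSupport A m = ∃[ i ] ∃[ j ] ∃[ x ] (A i j ≡ just x × ∣ x ∣ ≡ m)

SupportIs : ∀ {n} → PArray n → ℕ → ℕ → Set
SupportIs {n} A s t = ∀ m → InSupport A m ⇔
  (∃[ i ] ((1 ≤ i × i ≤ 2 ℕ.* n) × (m ≡ s ℕ.+ i ⊎ m ≡ t ℕ.+ i)))

_∪_ : ∀ {n} → CellSet n → CellSet n → CellSet n
(S ∪ T) c = S c ⊎ T c

-- Write a Hamilton cycle as a_{σ0} b_{τ0} a_{σ1} b_{τ1} … a_{σ(n-1)} b_{τ(n-1)} and number its 2n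
-- edges from the one leaving row 0.  Putting the values u+1, u+2, …, u+2n on consecutive edges with
-- alternating signs, every column meets the cycle in two consecutive edges and sums to ∓1, and so does
-- every row except row 0, where the last and the first edge meet and the sum is ±(2n−1).  Using base s
-- and first sign − on S₁ and base t and first sign + on S₂, these line sums cancel in every row and
-- column, and since consecutive edges carry opposite signs each line has two positive and two negative
-- entries.
module Submission where

open import Defs
open import Data.Nat using (ℕ; zero; suc; _+_; _*_; _∸_; _<_; _≤_; z≤n; s≤s; NonZero)
open import Data.Nat.Properties
  using (suc-injective; 1+n≢n; m≤n⇒m<n∨m≡n; <⇒≤; m+[n∸m]≡n; +-comm; +-assoc; +-suc;
         *-suc; *-monoʳ-≤; *-cancelˡ-<; ≤-trans; n≤1+n)
open import Data.Nat.DivMod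
import Data.Nat.Tactic.RingSolver as ℕ-Solver
open import Data.Fin as Fin using (Fin; toℕ; fromℕ<; punchIn; punchOut; _≟_)
open import Data.Fin.Properties
  using (toℕ-fromℕ<; toℕ-injective; toℕ<n; toℕ-inject₁; toℕ-fromℕ;
         punchIn-injective; punchIn-punchOut; punchInᵢ≢i)
open import Data.Fin.Permutation using (Permutation′; _⟨$⟩ʳ_; _⟨$⟩ˡ_; inverseˡ; inverseʳ)
open import Data.Integer as ℤ using (ℤ; -[1+_]; 0ℤ; 1ℤ; -1ℤ; _◃_; ∣_∣)
import Data.Integer.Properties as ℤ
open import Data.Integer.Tactic.RingSolver using (solve-∀)
open import Data.Sign as Sign using (Sign; opposite)
open import Data.List using ([]; _∷_; map; mapMaybe; allFin; tabulate)
open import Data.List.Properties using (map-tabulate)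
open import Data.Maybe as Maybe using (Maybe; just; nothing; Is-just; _<∣>_)
open import Data.Maybe.Properties using (map-<∣>)
open import Data.Maybe.Relation.Unary.Any using (just)
open import Data.Unit using (tt)
open import Data.Empty using (⊥; ⊥-elim)
open import Data.Product using (_×_; _,_; ∃-syntax; ∃₂)
open import Data.Sum using (_⊎_; inj₁; inj₂)
open import Function using (_∘_; Injection)
open import Function.Bundles using (_⇔_; mk⇔; Equivalence; mk⤖)
open import Function.Construct.Composition using (_⇔-∘_)
open import Function.Construct.Symmetry using (⇔-sym)
open import Data.Sum.Function.Propositional using (_⊎-⇔_)
open import Function.Properties.Bijection using (Bijection⇒Inverse)
open import Function.Properties.Inverse using (↔⇒↣)
open import Relation.Binary.PropositionalEquality
open import Relation.Nullary using (yes; no; contradiction)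
open import Algebra.Properties.CommutativeMonoid.Sum ℤ.+-0-commutativeMonoid
  using (sum; sum-syntax; sum-cong-≗; sum-remove; sum-replicate-zero; ∑-distrib-+)

open ≡-Reasoning

val : Maybe ℤ → ℤ
val = Maybe.fromMaybe 0ℤ

sum-single : ∀ {n} (f : Fin n → ℤ) c → (∀ j → j ≢ c → f j ≡ 0ℤ) → sum f ≡ f c
sum-single {suc n} f c off = begin
  sum f                               ≡⟨ sum-remove {i = c} f ⟩
  f c ℤ.+ sum (λ j → f (punchIn c j)) ≡⟨ cong (ℤ._+_ (f c)) (sum-cong-≗ (λ j → off _ (punchInᵢ≢i c j))) ⟩
  f c ℤ.+ sum {n} (λ _ → 0ℤ)          ≡⟨ cong (ℤ._+_ (f c)) (sum-replicate-zero n) ⟩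
  f c ℤ.+ 0ℤ                          ≡⟨ ℤ.+-identityʳ (f c) ⟩
  f c                                 ∎

sum-pair : ∀ {n} (f : Fin n → ℤ) {c d} → c ≢ d → (∀ j → j ≢ c → j ≢ d → f j ≡ 0ℤ) →
  sum f ≡ f c ℤ.+ f d
sum-pair {suc n} f {c} {d} c≢d off = begin
  sum f                                ≡⟨ sum-remove {i = c} f ⟩
  f c ℤ.+ sum (λ j → f (punchIn c j))  ≡⟨ cong (ℤ._+_ (f c)) (sum-single _ (punchOut c≢d) off′) ⟩
  f c ℤ.+ f (punchIn c (punchOut c≢d)) ≡⟨ cong (λ j → f c ℤ.+ f j) (punchIn-punchOut c≢d) ⟩
  f c ℤ.+ f d                          ∎
  where
  off′ : ∀ j → j ≢ punchOut c≢d → f (punchIn c j) ≡ 0ℤ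
  off′ j j≢ = off _ (punchInᵢ≢i c j)
    (λ eq → j≢ (punchIn-injective c j _ (trans eq (sym (punchIn-punchOut c≢d)))))

sum-val-<∣> : ∀ {n} (g h : Fin n → Maybe ℤ) → (∀ j → Is-just (g j) → Is-just (h j) → ⊥) →
  ∑[ j < n ] val (g j <∣> h j) ≡ ∑[ j < n ] val (g j) ℤ.+ ∑[ j < n ] val (h j)
sum-val-<∣> g h disjoint =
  trans (sum-cong-≗ (λ j → val-<∣> (g j) (h j) (disjoint j))) (∑-distrib-+ (val ∘ g) (val ∘ h))
  where
  val-<∣> : ∀ x y → (Is-just x → Is-just y → ⊥) → val (x <∣> y) ≡ val x ℤ.+ val y
  val-<∣> (just x) (just y) disj = ⊥-elim (disj (just tt) (just tt))
  val-<∣> (just x) nothing  _    = sym (ℤ.+-identityʳ x)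
  val-<∣> nothing  y        _    = sym (ℤ.+-identityˡ (val y))

sumℤ-mapMaybe : ∀ {A : Set} (g : A → Maybe ℤ) xs → sumℤ (mapMaybe g xs) ≡ sumℤ (map (val ∘ g) xs)
sumℤ-mapMaybe g [] = refl
sumℤ-mapMaybe g (x ∷ xs) with g x
... | just y  = cong (ℤ._+_ y) (sumℤ-mapMaybe g xs)
... | nothing = trans (sumℤ-mapMaybe g xs) (sym (ℤ.+-identityˡ _))

sumℤ-tabulate : ∀ {n} (f : Fin n → ℤ) → sumℤ (tabulate f) ≡ sum f
sumℤ-tabulate {zero}  f = refl
sumℤ-tabulate {suc n} f = cong (ℤ._+_ (f Fin.zero)) (sumℤ-tabulate (f ∘ Fin.suc))

sumℤ-line : ∀ {n} (g : Fin n → Maybe ℤ) → sumℤ (mapMaybe g (allFin n)) ≡ ∑[ j < n ] val (g j)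
sumℤ-line {n} g = begin
  sumℤ (mapMaybe g (allFin n))        ≡⟨ sumℤ-mapMaybe g (allFin n) ⟩
  sumℤ (map (val ∘ g) (allFin n))     ≡⟨ cong sumℤ (map-tabulate (λ j → j) (val ∘ g)) ⟩
  sumℤ (tabulate (val ∘ g))           ≡⟨ sumℤ-tabulate (val ∘ g) ⟩
  ∑[ j < n ] val (g j)                ∎

signum : ℤ → ℤ
signum (ℤ.+ zero)   = 0ℤ
signum ℤ.+[1+ n ] = 1ℤ
signum -[1+ n ]   = -1ℤ

#pos-#neg : ∀ xs → ℤ.+ #pos xs ℤ.- ℤ.+ #neg xs ≡ sumℤ (map signum xs)
#pos-#neg []                = refl
#pos-#neg (ℤ.+ zero ∷ xs)   = trans (#pos-#neg xs) (sym (ℤ.+-identityˡ _))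
#pos-#neg (ℤ.+[1+ n ] ∷ xs) = trans (shift (ℤ.+ #pos xs) (ℤ.+ #neg xs)) (cong (ℤ._+_ 1ℤ) (#pos-#neg xs))
  where shift : ∀ a b → (1ℤ ℤ.+ a) ℤ.- b ≡ 1ℤ ℤ.+ (a ℤ.- b)
        shift = solve-∀
#pos-#neg (-[1+ n ] ∷ xs)   = trans (shift (ℤ.+ #pos xs) (ℤ.+ #neg xs)) (cong (ℤ._+_ -1ℤ) (#pos-#neg xs))
  where shift : ∀ a b → a ℤ.- (1ℤ ℤ.+ b) ≡ -1ℤ ℤ.+ (a ℤ.- b)
        shift = solve-∀

map-mapMaybe : ∀ {A : Set} (f : ℤ → ℤ) (g : A → Maybe ℤ) xs →
  map f (mapMaybe g xs) ≡ mapMaybe (Maybe.map f ∘ g) xs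
map-mapMaybe f g [] = refl
map-mapMaybe f g (x ∷ xs) with g x
... | just y  = cong (f y ∷_) (map-mapMaybe f g xs)
... | nothing = map-mapMaybe f g xs

#pos≡#neg-line : ∀ {n} (g : Fin n → Maybe ℤ) → ∑[ j < n ] val (Maybe.map signum (g j)) ≡ 0ℤ →
  #pos (mapMaybe g (allFin n)) ≡ #neg (mapMaybe g (allFin n))
#pos≡#neg-line {n} g signs-cancel = ℤ.+-injective (ℤ.i-j≡0⇒i≡j _ _ (begin
  ℤ.+ #pos line ℤ.- ℤ.+ #neg line                   ≡⟨ #pos-#neg line ⟩
  sumℤ (map signum line)                            ≡⟨ cong sumℤ (map-mapMaybe signum g (allFin n)) ⟩
  sumℤ (mapMaybe (Maybe.map signum ∘ g) (allFin n)) ≡⟨ sumℤ-line (Maybe.map signum ∘ g) ⟩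
  ∑[ j < n ] val (Maybe.map signum (g j))           ≡⟨ signs-cancel ⟩
  0ℤ                                                ∎))
  where line = mapMaybe g (allFin n)

toℕ-csuc : ∀ {m} (k : Fin (suc m)) → toℕ (csuc k) ≡ suc (toℕ k) % suc m
toℕ-csuc k = toℕ-fromℕ< _

toℕ-csuc-cases : ∀ {m} (k : Fin (suc m)) →
  (toℕ (csuc k) ≡ suc (toℕ k)) ⊎ (toℕ (csuc k) ≡ 0 × toℕ k ≡ m)
toℕ-csuc-cases {m} k with m≤n⇒m<n∨m≡n (toℕ<n k)
... | inj₁ k+1<n = inj₁ (trans (toℕ-csuc k) (m<n⇒m%n≡m k+1<n))
... | inj₂ k+1≡n =
  inj₂ (trans (toℕ-csuc k) (trans (cong (_% suc m) k+1≡n) (n%n≡0 (suc m))) , suc-injective k+1≡n)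

csuc-injective : ∀ {m} {a b : Fin (suc m)} → csuc a ≡ csuc b → a ≡ b
csuc-injective {a = a} {b} eq with toℕ-csuc-cases a | toℕ-csuc-cases b
... | inj₁ p | inj₁ q = toℕ-injective (suc-injective (trans (sym p) (trans (cong toℕ eq) q)))
... | inj₂ (_ , p) | inj₂ (_ , q) = toℕ-injective (trans p (sym q))
... | inj₁ p | inj₂ (q , _) with () ← trans (sym p) (trans (cong toℕ eq) q)
... | inj₂ (p , _) | inj₁ q with () ← trans (sym q) (trans (cong toℕ (sym eq)) p)

csuc-≢ : ∀ {m} (k : Fin (suc (suc m))) → csuc k ≢ k
csuc-≢ k eq with toℕ-csuc-cases k
... | inj₁ p = 1+n≢n (trans (sym p) (cong toℕ eq))
... | inj₂ (p , q) with () ← trans (sym q) (trans (sym (cong toℕ eq)) p)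

cpred : ∀ {m} → Fin (suc m) → Fin (suc m)
cpred {m} Fin.zero = Fin.fromℕ m
cpred (Fin.suc k)  = Fin.inject₁ k

csuc-cpred : ∀ {m} (k : Fin (suc m)) → csuc (cpred k) ≡ k
csuc-cpred {m} Fin.zero = toℕ-injective (begin
  toℕ (csuc (Fin.fromℕ m))       ≡⟨ toℕ-csuc (Fin.fromℕ m) ⟩
  suc (toℕ (Fin.fromℕ m)) % suc m ≡⟨ cong (λ x → suc x % suc m) (toℕ-fromℕ m) ⟩
  suc m % suc m                  ≡⟨ n%n≡0 (suc m) ⟩
  0                              ∎)
csuc-cpred {suc m} (Fin.suc k) = toℕ-injective (begin
  toℕ (csuc (Fin.inject₁ k))       ≡⟨ toℕ-csuc (Fin.inject₁ k) ⟩
  suc (toℕ (Fin.inject₁ k)) % suc (suc m) ≡⟨ cong (λ x → suc x % suc (suc m)) (toℕ-inject₁ k) ⟩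
  suc (toℕ k) % suc (suc m)        ≡⟨ m<n⇒m%n≡m (s≤s (toℕ<n k)) ⟩
  suc (toℕ k)                      ∎)

%-absorbˡ : ∀ a b n .{{_ : NonZero n}} → (a % n + b) % n ≡ (a + b) % n
%-absorbˡ a b n = begin
  (a % n + b) % n           ≡⟨ %-distribˡ-+ (a % n) b n ⟩
  (a % n % n + b % n) % n   ≡⟨ cong (λ x → (x + b % n) % n) (m%n%n≡m%n a n) ⟩
  (a % n + b % n) % n       ≡⟨ %-distribˡ-+ a b n ⟨
  (a + b) % n               ∎

%-absorbʳ : ∀ a b n .{{_ : NonZero n}} → (a + b % n) % n ≡ (a + b) % n
%-absorbʳ a b n = begin
  (a + b % n) % n ≡⟨ cong (_% n) (+-comm a (b % n)) ⟩
  (b % n + a) % n ≡⟨ %-absorbˡ b a n ⟩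
  (b + a) % n     ≡⟨ cong (_% n) (+-comm b a) ⟩
  (a + b) % n     ∎

-- (k − o) mod n, with the shift written as n ∸ o so that no truncated subtraction occurs.
stepsFrom : ∀ {m} → Fin (suc m) → Fin (suc m) → ℕ
stepsFrom {m} o k = (toℕ k + (suc m ∸ toℕ o)) % suc m

module _ {m} (o : Fin (suc m)) where
  private
    n = suc m
    d = n ∸ toℕ o
    o+d≡n : toℕ o + d ≡ n
    o+d≡n = m+[n∸m]≡n (<⇒≤ (toℕ<n o))

  stepsFrom<n : ∀ k → stepsFrom o k < n
  stepsFrom<n k = m%n<n (toℕ k + d) n

  stepsFrom-self : stepsFrom o o ≡ 0
  stepsFrom-self = trans (cong (_% n) o+d≡n) (n%n≡0 n)

  stepsFrom-inverse : ∀ k → (stepsFrom o k + toℕ o) % n ≡ toℕ k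
  stepsFrom-inverse k = begin
    ((toℕ k + d) % n + toℕ o) % n ≡⟨ %-absorbˡ (toℕ k + d) (toℕ o) n ⟩
    (toℕ k + d + toℕ o) % n       ≡⟨ cong (_% n) (trans (+-assoc (toℕ k) d (toℕ o))
                                                        (cong (toℕ k +_) (trans (+-comm d (toℕ o)) o+d≡n))) ⟩
    (toℕ k + n) % n               ≡⟨ [m+n]%n≡m%n (toℕ k) n ⟩
    toℕ k % n                     ≡⟨ m<n⇒m%n≡m (toℕ<n k) ⟩
    toℕ k                         ∎

  stepsFrom-injective : ∀ {a b} → stepsFrom o a ≡ stepsFrom o b → a ≡ b
  stepsFrom-injective {a} {b} eq = toℕ-injective
    (trans (sym (stepsFrom-inverse a)) (trans (cong (λ x → (x + toℕ o) % n) eq) (stepsFrom-inverse b)))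

  stepsFrom-surjective : ∀ {q} → q < n → ∃[ k ] stepsFrom o k ≡ q
  stepsFrom-surjective {q} q<n = fromℕ< q+o%n<n , (begin
    (toℕ (fromℕ< q+o%n<n) + d) % n ≡⟨ cong (λ x → (x + d) % n) (toℕ-fromℕ< q+o%n<n) ⟩
    ((q + toℕ o) % n + d) % n      ≡⟨ %-absorbˡ (q + toℕ o) d n ⟩
    (q + toℕ o + d) % n            ≡⟨ cong (_% n) (trans (+-assoc q (toℕ o) d) (cong (q +_) o+d≡n)) ⟩
    (q + n) % n                    ≡⟨ [m+n]%n≡m%n q n ⟩
    q % n                          ≡⟨ m<n⇒m%n≡m q<n ⟩
    q                              ∎)
    where q+o%n<n = m%n<n (q + toℕ o) n

  stepsFrom-csuc-% : ∀ k → stepsFrom o (csuc k) ≡ suc (stepsFrom o k) % n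
  stepsFrom-csuc-% k = begin
    (toℕ (csuc k) + d) % n         ≡⟨ cong (λ x → (x + d) % n) (toℕ-csuc k) ⟩
    (suc (toℕ k) % n + d) % n      ≡⟨ %-absorbˡ (suc (toℕ k)) d n ⟩
    suc (toℕ k + d) % n            ≡⟨ %-absorbʳ 1 (toℕ k + d) n ⟨
    suc ((toℕ k + d) % n) % n      ∎

  stepsFrom-csuc : ∀ k → csuc k ≢ o → stepsFrom o (csuc k) ≡ suc (stepsFrom o k)
  stepsFrom-csuc k k+1≢o with m≤n⇒m<n∨m≡n (stepsFrom<n k)
  ... | inj₁ lt = trans (stepsFrom-csuc-% k) (m<n⇒m%n≡m lt)
  ... | inj₂ eq = contradiction (stepsFrom-injective (begin
    stepsFrom o (csuc k)    ≡⟨ stepsFrom-csuc-% k ⟩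
    suc (stepsFrom o k) % n ≡⟨ cong (_% n) eq ⟩
    n % n                   ≡⟨ n%n≡0 n ⟩
    0                       ≡⟨ stepsFrom-self ⟨
    stepsFrom o o           ∎)) k+1≢o

  stepsFrom-last : ∀ k → csuc k ≡ o → stepsFrom o k ≡ m
  stepsFrom-last k k+1≡o with m≤n⇒m<n∨m≡n (stepsFrom<n k)
  ... | inj₂ eq = suc-injective eq
  ... | inj₁ lt with () ← begin
    suc (stepsFrom o k)     ≡⟨ m<n⇒m%n≡m lt ⟨
    suc (stepsFrom o k) % n ≡⟨ stepsFrom-csuc-% k ⟨
    stepsFrom o (csuc k)    ≡⟨ cong (stepsFrom o) k+1≡o ⟩
    stepsFrom o o           ≡⟨ stepsFrom-self ⟩
    0                       ∎

⟨$⟩ʳ-injective : ∀ {n} (π : Permutation′ n) {k l} → π ⟨$⟩ʳ k ≡ π ⟨$⟩ʳ l → k ≡ l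
⟨$⟩ʳ-injective π = Injection.injective (↔⇒↣ π)

⟨$⟩ˡ-injective : ∀ {n} (π : Permutation′ n) {k l} → π ⟨$⟩ˡ k ≡ π ⟨$⟩ˡ l → k ≡ l
⟨$⟩ˡ-injective π eq = trans (sym (inverseʳ π)) (trans (cong (π ⟨$⟩ʳ_) eq) (inverseʳ π))

CycleEdge : ∀ {n} → (σ τ : Permutation′ n) → Fin n → Fin n → Set
CycleEdge σ τ i j = ∃[ k ] ((i ≡ σ ⟨$⟩ʳ k × j ≡ τ ⟨$⟩ʳ k) ⊎ (i ≡ σ ⟨$⟩ʳ csuc k × j ≡ τ ⟨$⟩ʳ k))

entry : ∀ {n} → Permutation′ n → (α β : Fin n → ℤ) → Fin n → Fin n → Maybe ℤ
entry σ α β i k with i ≟ σ ⟨$⟩ʳ k | i ≟ σ ⟨$⟩ʳ csuc k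
... | yes _ | _     = just (α k)
... | no _  | yes _ = just (β k)
... | no _  | no _  = nothing

-- α k is the entry on the edge a_{σ k} b_{τ k} and β k the one on the edge b_{τ k} a_{σ (k+1)}.
fill : ∀ {n} → (σ τ : Permutation′ n) (α β : Fin n → ℤ) → PArray n
fill σ τ α β i j = entry σ α β i (τ ⟨$⟩ˡ j)

map-fill : ∀ {n} (f : ℤ → ℤ) σ τ (α β : Fin n → ℤ) i j →
  Maybe.map f (fill σ τ α β i j) ≡ fill σ τ (f ∘ α) (f ∘ β) i j
map-fill f σ τ α β i j with i ≟ σ ⟨$⟩ʳ (τ ⟨$⟩ˡ j) | i ≟ σ ⟨$⟩ʳ csuc (τ ⟨$⟩ˡ j)
... | yes _ | _     = refl
... | no _  | yes _ = refl
... | no _  | no _  = refl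

module _ {m} (σ τ : Permutation′ (suc (suc m))) (α β : Fin (suc (suc m)) → ℤ) where
  private
    F = fill σ τ α β

  entry-σ : ∀ k → entry σ α β (σ ⟨$⟩ʳ k) k ≡ just (α k)
  entry-σ k with σ ⟨$⟩ʳ k ≟ σ ⟨$⟩ʳ k
  ... | yes _    = refl
  ... | no σk≢σk = contradiction refl σk≢σk

  entry-σ-csuc : ∀ k → entry σ α β (σ ⟨$⟩ʳ csuc k) k ≡ just (β k)
  entry-σ-csuc k with σ ⟨$⟩ʳ csuc k ≟ σ ⟨$⟩ʳ k | σ ⟨$⟩ʳ csuc k ≟ σ ⟨$⟩ʳ csuc k
  ... | yes eq | _     = contradiction (⟨$⟩ʳ-injective σ eq) (csuc-≢ k)
  ... | no _   | yes _ = refl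
  ... | no _   | no ne = contradiction refl ne

  entry-nothing : ∀ i k → i ≢ σ ⟨$⟩ʳ k → i ≢ σ ⟨$⟩ʳ csuc k → entry σ α β i k ≡ nothing
  entry-nothing i k ne₁ ne₂ with i ≟ σ ⟨$⟩ʳ k | i ≟ σ ⟨$⟩ʳ csuc k
  ... | yes eq | _      = contradiction eq ne₁
  ... | no _   | yes eq = contradiction eq ne₂
  ... | no _   | no _   = refl

  entry-just : ∀ i k {x} → entry σ α β i k ≡ just x →
    (i ≡ σ ⟨$⟩ʳ k × x ≡ α k) ⊎ (i ≡ σ ⟨$⟩ʳ csuc k × x ≡ β k)
  entry-just i k eq with i ≟ σ ⟨$⟩ʳ k | i ≟ σ ⟨$⟩ʳ csuc k
  entry-just i k refl | yes p | _     = inj₁ (p , refl)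
  entry-just i k refl | no _  | yes p = inj₂ (p , refl)

  fill-α : ∀ k → F (σ ⟨$⟩ʳ k) (τ ⟨$⟩ʳ k) ≡ just (α k)
  fill-α k = trans (cong (entry σ α β _) (inverseˡ τ)) (entry-σ k)

  fill-β : ∀ k → F (σ ⟨$⟩ʳ csuc k) (τ ⟨$⟩ʳ k) ≡ just (β k)
  fill-β k = trans (cong (entry σ α β _) (inverseˡ τ)) (entry-σ-csuc k)

  fill-just : ∀ i j {x} → F i j ≡ just x → ∃[ k ] (x ≡ α k ⊎ x ≡ β k)
  fill-just i j eq with entry-just i (τ ⟨$⟩ˡ j) eq
  ... | inj₁ (_ , x≡α) = τ ⟨$⟩ˡ j , inj₁ x≡α
  ... | inj₂ (_ , x≡β) = τ ⟨$⟩ˡ j , inj₂ x≡β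

  fill-isJust : ∀ i j → Is-just (F i j) ⇔ CycleEdge σ τ i j
  fill-isJust i j = mk⇔ to from
    where
    to : Is-just (F i j) → CycleEdge σ τ i j
    to p with F i j in eq
    to (just _) | just x with entry-just i (τ ⟨$⟩ˡ j) eq
    ... | inj₁ (i≡ , _) = τ ⟨$⟩ˡ j , inj₁ (i≡ , sym (inverseʳ τ))
    ... | inj₂ (i≡ , _) = τ ⟨$⟩ˡ j , inj₂ (i≡ , sym (inverseʳ τ))
    from : CycleEdge σ τ i j → Is-just (F i j)
    from (k , inj₁ (refl , refl)) = subst Is-just (sym (fill-α k)) (just tt)
    from (k , inj₂ (refl , refl)) = subst Is-just (sym (fill-β k)) (just tt)

  column-sum : ∀ j → ∑[ i < suc (suc m) ] val (F i j) ≡ α (τ ⟨$⟩ˡ j) ℤ.+ β (τ ⟨$⟩ˡ j)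
  column-sum j = trans (sum-pair _ σk≢σk+1 (λ i ne₁ ne₂ → cong val (entry-nothing i k ne₁ ne₂)))
                       (cong₂ ℤ._+_ (cong val (entry-σ k)) (cong val (entry-σ-csuc k)))
    where
    k = τ ⟨$⟩ˡ j
    σk≢σk+1 : σ ⟨$⟩ʳ k ≢ σ ⟨$⟩ʳ csuc k
    σk≢σk+1 eq = csuc-≢ k (⟨$⟩ʳ-injective σ (sym eq))

  row-sum-σ-csuc : ∀ k → ∑[ j < suc (suc m) ] val (F (σ ⟨$⟩ʳ csuc k) j) ≡ α (csuc k) ℤ.+ β k
  row-sum-σ-csuc k = trans (sum-pair _ τk+1≢τk off)
                           (cong₂ ℤ._+_ (cong val (fill-α (csuc k))) (cong val (fill-β k)))
    where
    τk+1≢τk : τ ⟨$⟩ʳ csuc k ≢ τ ⟨$⟩ʳ k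
    τk+1≢τk = csuc-≢ k ∘ ⟨$⟩ʳ-injective τ
    τ-of : ∀ {j l} → l ≡ τ ⟨$⟩ˡ j → j ≡ τ ⟨$⟩ʳ l
    τ-of l≡ = trans (sym (inverseʳ τ)) (cong (τ ⟨$⟩ʳ_) (sym l≡))
    off : ∀ j → j ≢ τ ⟨$⟩ʳ csuc k → j ≢ τ ⟨$⟩ʳ k → val (F (σ ⟨$⟩ʳ csuc k) j) ≡ 0ℤ
    off j ne₁ ne₂ = cong val (entry-nothing _ (τ ⟨$⟩ˡ j)
      (ne₁ ∘ τ-of ∘ ⟨$⟩ʳ-injective σ)
      (ne₂ ∘ τ-of ∘ csuc-injective ∘ ⟨$⟩ʳ-injective σ))

  row-sum : ∀ i → ∑[ j < suc (suc m) ] val (F i j) ≡ α (σ ⟨$⟩ˡ i) ℤ.+ β (cpred (σ ⟨$⟩ˡ i))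
  row-sum i = begin
    ∑[ j < suc (suc m) ] val (F i j)               ≡⟨ cong (λ i → ∑[ j < suc (suc m) ] val (F i j)) i≡ ⟩
    ∑[ j < suc (suc m) ] val (F (σ ⟨$⟩ʳ csuc k) j) ≡⟨ row-sum-σ-csuc k ⟩
    α (csuc k) ℤ.+ β k                             ≡⟨ cong (λ l → α l ℤ.+ β k) (csuc-cpred _) ⟩
    α (σ ⟨$⟩ˡ i) ℤ.+ β k                           ∎
    where
    k = cpred (σ ⟨$⟩ˡ i)
    i≡ : i ≡ σ ⟨$⟩ʳ csuc k
    i≡ = trans (sym (inverseʳ σ)) (cong (σ ⟨$⟩ʳ_) (sym (csuc-cpred _)))

◃-cancel : ∀ s n → (s ◃ n) ℤ.+ (opposite s ◃ n) ≡ 0ℤ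
◃-cancel Sign.+ n = trans (cong₂ ℤ._+_ (ℤ.+◃n≡+n n) (ℤ.-◃n≡-n n)) (ℤ.+-inverseʳ (ℤ.+ n))
◃-cancel Sign.- n = trans (cong₂ ℤ._+_ (ℤ.-◃n≡-n n) (ℤ.+◃n≡+n n)) (ℤ.+-inverseˡ (ℤ.+ n))

◃-+-cancelʳ : ∀ s d n → (s ◃ (d + n)) ℤ.+ (opposite s ◃ n) ≡ s ◃ d
◃-+-cancelʳ s d n = begin
  (s ◃ (d + n)) ℤ.+ (opposite s ◃ n)             ≡⟨ cong (ℤ._+ (opposite s ◃ n)) (ℤ.◃-distrib-+ s d n) ⟩
  ((s ◃ d) ℤ.+ (s ◃ n)) ℤ.+ (opposite s ◃ n)     ≡⟨ ℤ.+-assoc (s ◃ d) (s ◃ n) (opposite s ◃ n) ⟩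
  (s ◃ d) ℤ.+ ((s ◃ n) ℤ.+ (opposite s ◃ n))     ≡⟨ cong (ℤ._+_ (s ◃ d)) (◃-cancel s n) ⟩
  (s ◃ d) ℤ.+ 0ℤ                                 ≡⟨ ℤ.+-identityʳ (s ◃ d) ⟩
  s ◃ d                                          ∎

◃-+-cancelˡ : ∀ s d n → (s ◃ n) ℤ.+ (opposite s ◃ (d + n)) ≡ opposite s ◃ d
◃-+-cancelˡ Sign.+ d n = trans (ℤ.+-comm (Sign.+ ◃ n) (Sign.- ◃ (d + n))) (◃-+-cancelʳ Sign.- d n)
◃-+-cancelˡ Sign.- d n = trans (ℤ.+-comm (Sign.- ◃ n) (Sign.+ ◃ (d + n))) (◃-+-cancelʳ Sign.+ d n)

signum-◃ : ∀ s n → signum (s ◃ suc n) ≡ s ◃ 1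
signum-◃ Sign.+ n = refl
signum-◃ Sign.- n = refl

parity : ∀ n → ∃[ q ] (n ≡ 2 * q ⊎ n ≡ suc (2 * q))
parity zero = 0 , inj₁ refl
parity (suc n) with parity n
... | q , inj₁ n≡2q = q , inj₂ (cong suc n≡2q)
... | q , inj₂ n≡2q+1 = suc q , inj₁ (trans (cong suc n≡2q+1) (sym (*-suc 2 q)))

2*<⇒< : ∀ {q n} → suc (2 * q) ≤ 2 * n → q < n
2*<⇒< {q} {n} = *-cancelˡ-< 2 q n

<⇒2*≤ : ∀ {q n} → q < n → suc (suc (2 * q)) ≤ 2 * n
<⇒2*≤ {q} {n} q<n = subst (_≤ 2 * n) (*-suc 2 q) (*-monoʳ-≤ 2 q<n)

InRange : ℕ → ℕ → ℕ → Set
InRange u n x = ∃[ i ] ((1 ≤ i × i ≤ 2 * n) × x ≡ u + i)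

inRange-⊎ : ∀ {s t n x} →
  (InRange s n x ⊎ InRange t n x) ⇔ (∃[ i ] ((1 ≤ i × i ≤ 2 * n) × (x ≡ s + i ⊎ x ≡ t + i)))
inRange-⊎ {s} {t} {n} {x} = mk⇔ to from
  where
  to : InRange s n x ⊎ InRange t n x → ∃[ i ] ((1 ≤ i × i ≤ 2 * n) × (x ≡ s + i ⊎ x ≡ t + i))
  to (inj₁ (i , bounds , eq)) = i , bounds , inj₁ eq
  to (inj₂ (i , bounds , eq)) = i , bounds , inj₂ eq
  from : ∃[ i ] ((1 ≤ i × i ≤ 2 * n) × (x ≡ s + i ⊎ x ≡ t + i)) → InRange s n x ⊎ InRange t n x
  from (i , bounds , inj₁ eq) = inj₁ (i , bounds , eq)
  from (i , bounds , inj₂ eq) = inj₂ (i , bounds , eq)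

module Labelling {m} (ε : Sign) (u : ℕ) (o : Fin (suc m)) where
  α β : Fin (suc m) → ℤ
  α k = ε ◃ suc (u + 2 * stepsFrom o k)
  β k = opposite ε ◃ suc (suc (u + 2 * stepsFrom o k))

  α+β : ∀ k → α k ℤ.+ β k ≡ opposite ε ◃ 1
  α+β k = ◃-+-cancelˡ ε 1 (suc (u + 2 * stepsFrom o k))

  α+β-cpred : ∀ k → k ≢ o → α k ℤ.+ β (cpred k) ≡ ε ◃ 1
  α+β-cpred k k≢o = trans (cong (λ x → (ε ◃ x) ℤ.+ β (cpred k)) shift) (◃-+-cancelʳ ε 1 _)
    where
    r = stepsFrom o (cpred k)
    arith : ∀ u r → suc (u + 2 * suc r) ≡ 1 + suc (suc (u + 2 * r))
    arith = ℕ-Solver.solve-∀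
    steps≡ : stepsFrom o k ≡ suc r
    steps≡ = trans (cong (stepsFrom o) (sym (csuc-cpred k)))
                   (stepsFrom-csuc o (cpred k) (λ eq → k≢o (trans (sym (csuc-cpred k)) eq)))
    shift : suc (u + 2 * stepsFrom o k) ≡ 1 + suc (suc (u + 2 * r))
    shift = trans (cong (λ x → suc (u + 2 * x)) steps≡) (arith u r)

  α+β-origin : α o ℤ.+ β (cpred o) ≡ opposite ε ◃ suc (2 * m)
  α+β-origin = trans (cong₂ (λ x y → (ε ◃ suc (u + 2 * x)) ℤ.+ (opposite ε ◃ y)) (stepsFrom-self o) shift)
                     (◃-+-cancelˡ ε (suc (2 * m)) (suc (u + 2 * 0)))
    where
    arith : ∀ u m → suc (suc (u + 2 * m)) ≡ suc (2 * m) + suc (u + 2 * 0)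
    arith = ℕ-Solver.solve-∀
    shift : suc (suc (u + 2 * stepsFrom o (cpred o))) ≡ suc (2 * m) + suc (u + 2 * 0)
    shift = trans (cong (λ x → suc (suc (u + 2 * x))) (stepsFrom-last o (cpred o) (csuc-cpred o))) (arith u m)

  signum-α+β : ∀ k l → signum (α k) ℤ.+ signum (β l) ≡ 0ℤ
  signum-α+β k l = trans (cong₂ ℤ._+_ (signum-◃ ε _) (signum-◃ (opposite ε) _)) (◃-cancel ε 1)

  ∣α∣-inRange : ∀ k → InRange u (suc m) ∣ α k ∣
  ∣α∣-inRange k = suc (2 * stepsFrom o k) , (s≤s z≤n , ≤-trans (n≤1+n _) (<⇒2*≤ (stepsFrom<n o k))) ,
    trans (ℤ.abs-◃ ε _) (sym (+-suc u _))

  ∣β∣-inRange : ∀ k → InRange u (suc m) ∣ β k ∣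
  ∣β∣-inRange k = suc (suc (2 * stepsFrom o k)) , (s≤s z≤n , <⇒2*≤ (stepsFrom<n o k)) ,
    trans (ℤ.abs-◃ (opposite ε) _) (sym (trans (+-suc u _) (cong suc (+-suc u _))))

  inRange-covered : ∀ {x} → InRange u (suc m) x → ∃[ k ] (x ≡ ∣ α k ∣ ⊎ x ≡ ∣ β k ∣)
  inRange-covered (suc i , (_ , i<2n) , refl) with parity i
  ... | q , inj₁ refl with stepsFrom-surjective o (2*<⇒< {q} i<2n)
  ...   | k , refl = k , inj₁ (trans (+-suc u _) (sym (ℤ.abs-◃ ε _)))
  inRange-covered (suc i , (_ , i<2n) , refl) | q , inj₂ refl
    with stepsFrom-surjective o (2*<⇒< {q} (≤-trans (n≤1+n _) i<2n))
  ...   | k , refl =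
    k , inj₂ (trans (trans (+-suc u _) (cong suc (+-suc u _))) (sym (ℤ.abs-◃ (opposite ε) _)))

_⊕_ : ∀ {n} → PArray n → PArray n → PArray n
(A ⊕ B) i j = A i j <∣> B i j

Apart : ∀ {n} → PArray n → PArray n → Set
Apart A B = ∀ i j → Is-just (A i j) → Is-just (B i j) → ⊥

isJust-<∣> : ∀ {A : Set} (x y : Maybe A) → Is-just (x <∣> y) ⇔ (Is-just x ⊎ Is-just y)
isJust-<∣> x y = mk⇔ (to x) (from x)
  where
  to : ∀ x → Is-just (x <∣> y) → Is-just x ⊎ Is-just y
  to (just _) p = inj₁ p
  to nothing  p = inj₂ p
  from : ∀ x → Is-just x ⊎ Is-just y → Is-just (x <∣> y)
  from (just _) _        = just tt
  from nothing  (inj₂ p) = p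

<∣>-just : ∀ {A : Set} (x y : Maybe A) {v} → (x <∣> y) ≡ just v → x ≡ just v ⊎ y ≡ just v
<∣>-just (just _) y eq = inj₁ eq
<∣>-just nothing  y eq = inj₂ eq

<∣>-justʳ : ∀ {A : Set} (x y : Maybe A) {v} → (Is-just x → ⊥) → y ≡ just v → (x <∣> y) ≡ just v
<∣>-justʳ (just _) y ¬x _  = ⊥-elim (¬x (just tt))
<∣>-justʳ nothing  y _  eq = eq

filledExactly⇒apart : ∀ {n} {A B : PArray n} {S T} →
  FilledExactly A S → FilledExactly B T → Disjoint S T → Apart A B
filledExactly⇒apart A≈S B≈T S∩T=∅ i j p q =
  S∩T=∅ (i , j) (Equivalence.to (A≈S i j) p) (Equivalence.to (B≈T i j) q)

⊕-filledExactly : ∀ {n} {A B : PArray n} {S T} →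
  FilledExactly A S → FilledExactly B T → FilledExactly (A ⊕ B) (S ∪ T)
⊕-filledExactly {A = A} {B} A≈S B≈T i j = (A≈S i j ⊎-⇔ B≈T i j) ⇔-∘ isJust-<∣> (A i j) (B i j)

⊕-support : ∀ {n} {A B : PArray n} → Apart A B → ∀ x → InSupport (A ⊕ B) x ⇔ (InSupport A x ⊎ InSupport B x)
⊕-support {A = A} {B} apart x = mk⇔ to from
  where
  to : InSupport (A ⊕ B) x → InSupport A x ⊎ InSupport B x
  to (i , j , y , eq , ∣y∣≡x) with <∣>-just (A i j) (B i j) eq
  ... | inj₁ eqA = inj₁ (i , j , y , eqA , ∣y∣≡x)
  ... | inj₂ eqB = inj₂ (i , j , y , eqB , ∣y∣≡x)
  from : InSupport A x ⊎ InSupport B x → InSupport (A ⊕ B) x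
  from (inj₁ (i , j , y , eqA , ∣y∣≡x)) = i , j , y , cong (_<∣> B i j) eqA , ∣y∣≡x
  from (inj₂ (i , j , y , eqB , ∣y∣≡x)) =
    i , j , y , <∣>-justʳ (A i j) (B i j) (λ p → apart i j p (subst Is-just (sym eqB) (just tt))) eqB , ∣y∣≡x

fill-filledExactly : ∀ {m} {S : CellSet (suc (suc m))} σ τ (α β : Fin (suc (suc m)) → ℤ) →
  (∀ i j → S (i , j) ⇔ CycleEdge σ τ i j) → FilledExactly (fill σ τ α β) S
fill-filledExactly σ τ α β S⇔ i j = ⇔-sym (S⇔ i j) ⇔-∘ fill-isJust σ τ α β i j

module LabelledCycle {m} (σ τ : Permutation′ (suc (suc m))) (ε : Sign) (u : ℕ) where
  open Labelling ε u (σ ⟨$⟩ˡ Fin.zero) public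

  F : PArray (suc (suc m))
  F = fill σ τ α β

  support : ∀ x → InSupport F x ⇔ InRange u (suc (suc m)) x
  support x = mk⇔ to from
    where
    to : InSupport F x → InRange u (suc (suc m)) x
    to (i , j , y , eq , refl) with fill-just σ τ α β i j eq
    ... | k , inj₁ refl = ∣α∣-inRange k
    ... | k , inj₂ refl = ∣β∣-inRange k
    from : InRange u (suc (suc m)) x → InSupport F x
    from x∈ with inRange-covered x∈
    ... | k , inj₁ refl = σ ⟨$⟩ʳ k , τ ⟨$⟩ʳ k , α k , fill-α σ τ α β k , refl
    ... | k , inj₂ refl = σ ⟨$⟩ʳ csuc k , τ ⟨$⟩ʳ k , β k , fill-β σ τ α β k , refl

module TwoCycles {m} {S₁ S₂ : CellSet (suc (suc m))} (σ₁ τ₁ σ₂ τ₂ : Permutation′ (suc (suc m)))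
  (S₁⇔ : ∀ i j → S₁ (i , j) ⇔ CycleEdge σ₁ τ₁ i j) (S₂⇔ : ∀ i j → S₂ (i , j) ⇔ CycleEdge σ₂ τ₂ i j)
  (S₁∩S₂=∅ : Disjoint S₁ S₂) (s t : ℕ) where

  private
    n = suc (suc m)
    module C₁ = LabelledCycle σ₁ τ₁ Sign.- s
    module C₂ = LabelledCycle σ₂ τ₂ Sign.+ t
    r₁ r₂ c₁ c₂ : Fin n → Fin n
    r₁ i = σ₁ ⟨$⟩ˡ i
    r₂ i = σ₂ ⟨$⟩ˡ i
    c₁ j = τ₁ ⟨$⟩ˡ j
    c₂ j = τ₂ ⟨$⟩ˡ j

  array : PArray n
  array = C₁.F ⊕ C₂.F

  filled : FilledExactly array (S₁ ∪ S₂)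
  filled = ⊕-filledExactly (fill-filledExactly σ₁ τ₁ _ _ S₁⇔) (fill-filledExactly σ₂ τ₂ _ _ S₂⇔)

  apart : ∀ α₁ β₁ α₂ β₂ → Apart (fill σ₁ τ₁ α₁ β₁) (fill σ₂ τ₂ α₂ β₂)
  apart α₁ β₁ α₂ β₂ = filledExactly⇒apart
    (fill-filledExactly σ₁ τ₁ α₁ β₁ S₁⇔) (fill-filledExactly σ₂ τ₂ α₂ β₂ S₂⇔) S₁∩S₂=∅

  row-sum-⊕ : ∀ α₁ β₁ α₂ β₂ i → ∑[ j < n ] val ((fill σ₁ τ₁ α₁ β₁ ⊕ fill σ₂ τ₂ α₂ β₂) i j) ≡
    (α₁ (r₁ i) ℤ.+ β₁ (cpred (r₁ i))) ℤ.+ (α₂ (r₂ i) ℤ.+ β₂ (cpred (r₂ i)))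
  row-sum-⊕ α₁ β₁ α₂ β₂ i = trans (sum-val-<∣> _ _ (apart α₁ β₁ α₂ β₂ i))
    (cong₂ ℤ._+_ (row-sum σ₁ τ₁ α₁ β₁ i) (row-sum σ₂ τ₂ α₂ β₂ i))

  column-sum-⊕ : ∀ α₁ β₁ α₂ β₂ j → ∑[ i < n ] val ((fill σ₁ τ₁ α₁ β₁ ⊕ fill σ₂ τ₂ α₂ β₂) i j) ≡
    (α₁ (c₁ j) ℤ.+ β₁ (c₁ j)) ℤ.+ (α₂ (c₂ j) ℤ.+ β₂ (c₂ j))
  column-sum-⊕ α₁ β₁ α₂ β₂ j = trans (sum-val-<∣> _ _ (λ i → apart α₁ β₁ α₂ β₂ i j))
    (cong₂ ℤ._+_ (column-sum σ₁ τ₁ α₁ β₁ j) (column-sum σ₂ τ₂ α₂ β₂ j))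

  row-values : ∀ i → (C₁.α (r₁ i) ℤ.+ C₁.β (cpred (r₁ i))) ℤ.+ (C₂.α (r₂ i) ℤ.+ C₂.β (cpred (r₂ i))) ≡ 0ℤ
  row-values i with i ≟ Fin.zero
  ... | yes refl = trans (cong₂ ℤ._+_ C₁.α+β-origin C₂.α+β-origin) (◃-cancel Sign.+ (suc (2 * suc m)))
  ... | no i≢0   = trans (cong₂ ℤ._+_ (C₁.α+β-cpred (r₁ i) (i≢0 ∘ ⟨$⟩ˡ-injective σ₁))
                                      (C₂.α+β-cpred (r₂ i) (i≢0 ∘ ⟨$⟩ˡ-injective σ₂)))
                         (◃-cancel Sign.- 1)

  column-values : ∀ j → (C₁.α (c₁ j) ℤ.+ C₁.β (c₁ j)) ℤ.+ (C₂.α (c₂ j) ℤ.+ C₂.β (c₂ j)) ≡ 0ℤ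
  column-values j = trans (cong₂ ℤ._+_ (C₁.α+β (c₁ j)) (C₂.α+β (c₂ j))) (◃-cancel Sign.+ 1)

  row-sums : ∀ i → sumℤ (rowEntries array i) ≡ 0ℤ
  row-sums i = trans (sumℤ-line (array i)) (trans (row-sum-⊕ _ _ _ _ i) (row-values i))

  column-sums : ∀ j → sumℤ (colEntries array j) ≡ 0ℤ
  column-sums j = trans (sumℤ-line (λ i → array i j)) (trans (column-sum-⊕ _ _ _ _ j) (column-values j))

  signs : ∀ i j → Maybe.map signum (array i j) ≡
    (fill σ₁ τ₁ (signum ∘ C₁.α) (signum ∘ C₁.β) ⊕ fill σ₂ τ₂ (signum ∘ C₂.α) (signum ∘ C₂.β)) i j
  signs i j = trans (map-<∣> signum (C₁.F i j) (C₂.F i j))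
    (cong₂ _<∣>_ (map-fill signum σ₁ τ₁ _ _ i j) (map-fill signum σ₂ τ₂ _ _ i j))

  shiftable : Shiftable array
  shiftable = rows , columns
    where
    rows : ∀ i → #pos (rowEntries array i) ≡ #neg (rowEntries array i)
    rows i = #pos≡#neg-line (array i) (trans (sum-cong-≗ (cong val ∘ signs i)) (trans (row-sum-⊕ _ _ _ _ i)
      (cong₂ ℤ._+_ (C₁.signum-α+β (r₁ i) (cpred (r₁ i))) (C₂.signum-α+β (r₂ i) (cpred (r₂ i))))))
    columns : ∀ j → #pos (colEntries array j) ≡ #neg (colEntries array j)
    columns j = #pos≡#neg-line (λ i → array i j) (trans (sum-cong-≗ (λ i → cong val (signs i j)))
      (trans (column-sum-⊕ _ _ _ _ j)
        (cong₂ ℤ._+_ (C₁.signum-α+β (c₁ j) (c₁ j)) (C₂.signum-α+β (c₂ j) (c₂ j)))))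

  support : SupportIs array s t
  support x = inRange-⊎ {s} {t} {n} ⇔-∘ ((C₁.support x ⊎-⇔ C₂.support x) ⇔-∘ ⊕-support (apart _ _ _ _) x)

hamiltonCycle⇒permutations : ∀ {n} {S : CellSet n} → IsHamiltonCycle S →
  ∃₂ λ (σ τ : Permutation′ n) → ∀ i j → S (i , j) ⇔ CycleEdge σ τ i j
hamiltonCycle⇒permutations (_ , _ , _ , σ-bijective , τ-bijective , S⇔) =
  Bijection⇒Inverse (mk⤖ σ-bijective) , Bijection⇒Inverse (mk⤖ τ-bijective) , S⇔

lemma2p3 : (n : ℕ) (S₁ S₂ : CellSet n) →
    IsHamiltonCycle S₁ → IsHamiltonCycle S₂ → Disjoint S₁ S₂ →
    (t s : ℕ) → 1 ≤ t → 1 ≤ s → t + 2 * n < s →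
    ∃[ A ] (FilledExactly A (S₁ ∪ S₂) × Shiftable A × SupportIs A s t ×
      (∀ i → sumℤ (rowEntries A i) ≡ 0ℤ) × (∀ j → sumℤ (colEntries A j) ≡ 0ℤ))
lemma2p3 zero          _  _  (() , _)    _  _  _ _ _ _ _
lemma2p3 (suc zero)    _  _  (s≤s () , _) _ _  _ _ _ _ _
lemma2p3 (suc (suc m)) S₁ S₂ H₁ H₂ S₁∩S₂=∅ t s _ _ _
  with hamiltonCycle⇒permutations H₁ | hamiltonCycle⇒permutations H₂
... | σ₁ , τ₁ , S₁⇔ | σ₂ , τ₂ , S₂⇔ = array , filled , shiftable , support , row-sums , column-sums
  where open TwoCycles σ₁ τ₁ σ₂ τ₂ S₁⇔ S₂⇔ S₁∩S₂=∅ s t
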